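{- Let $G$ be a finite simple graph and let $L = x_1 x_2 \dots x_n$ be an enumeration of its vertices. Suppose that $G$ has no secant edges with respect to $L$. Then $G$ is $3$-colorable, i.e. $\chi(G) \le 3$.
   Context: An edge $x_i x_j$ of $G$ is a jump with respect to $L$ if $|i-j|>1$. Two jumps $x_l x_m$ and $x_p x_q$ with $l<m$ and $p<q$ are secant edges with respect to $L$ if $l<p<m<q$ or $p<l<q<m$. -}

module Defs where

open import Data.Nat using (ℕ; suc; _<_)
open import Data.Fin using (Fin; toℕ)
open import Data.Product using (_×_)
open import Data.Sum using (_⊎_)
open import Relation.Nullary using (¬_; Dec)
open import Relation.Binary.PropositionalEquality using (_≡_)

-- The vertex i : Fin n plays
-- the role of x_(i+1) in the enumeration L = x_1 ... x_n, so the order on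
-- indices is the order of L.
record Graph (n : ℕ) : Set₁ where
  field
    Adj     : Fin n → Fin n → Set
    adj?    : (i j : Fin n) → Dec (Adj i j)
    sym     : ∀ {i j} → Adj i j → Adj j i
    irrefl  : ∀ i → ¬ Adj i i

open Graph public

OrderedJump : ∀ {n} → Graph n → Fin n → Fin n → Set
OrderedJump G l m = Adj G l m × suc (toℕ l) < toℕ m

Secant : ∀ {n} → Graph n → Fin n → Fin n → Fin n → Fin n → Set
Secant G l m p q =
  OrderedJump G l m × OrderedJump G p q ×
  ((toℕ l < toℕ p × toℕ p < toℕ m × toℕ m < toℕ q)
   ⊎ (toℕ p < toℕ l × toℕ l < toℕ q × toℕ q < toℕ m))

NoSecantEdges : ∀ {n} → Graph n → Set
NoSecantEdges G = ∀ l m p q → ¬ Secant G l m p q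

ProperColouring : ∀ {n} → Graph n → (k : ℕ) → (Fin n → Fin k) → Set
ProperColouring G k c = ∀ i j → Adj G i j → ¬ (c i ≡ c j)

-- A graph with no secant edges is 2-degenerate: if every vertex had three
-- distinct neighbours, vertex x_1 would be the left end of a jump, and the
-- successor x_(a+1) of the left end of any jump x_a x_b, having all its
-- neighbours in [x_a, x_b] (anything outside would cross the jump), would
-- start a strictly shorter jump nested inside it.  Deleting a vertex keeps the
-- enumeration free of secant edges, so greedy colouring with three colours
-- succeeds.
module Submission where

open import Defs hiding (sym)
open import Data.Nat using (ℕ; zero; suc; _+_; _≤_; _<_; z≤n; s≤s; _≤?_; _<?_)
open import Data.Nat.Properties
  using (≤-trans; n≤1+n; <-trans; ≤-<-trans; <⇒≱; ≰⇒>; n<1+n; m≤n⇒m<n∨m≡n; +-suc;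
         +-monoʳ-≤; m≤m+n; module ≤-Reasoning)
open import Data.Fin using (Fin; zero; suc; toℕ; punchIn; punchOut; fromℕ<; _≟_)
  renaming (_<_ to _<ᶠ_)
open import Data.Fin.Properties
  using (toℕ-injective; toℕ-fromℕ<; toℕ<n; any?; pigeonhole; punchIn-injective;
         punchIn-punchOut)
  renaming (<⇒≢ to <⇒≢ᶠ)
open import Data.Vec.Functional using (insertAt; []; _∷_)
open import Data.Vec.Functional.Properties using (insertAt-lookup; insertAt-punchIn)
open import Data.Product using (Σ; ∃; ∃₂; _×_; _,_; proj₁; proj₂; map)
open import Data.Sum using (_⊎_; inj₁; inj₂; [_,_]; [_,_]′; map₁)
open import Data.Empty using (⊥-elim)
open import Function using (_∘_; id)
open import Function.Definitions using (Injective)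
open import Level using (0ℓ)
open import Relation.Nullary using (¬_; Dec; yes; no; contradiction)
open import Relation.Nullary.Decidable using (_×-dec_; ¬?; decidable-stable)
open import Relation.Unary using (Pred; Decidable)
open import Relation.Binary.PropositionalEquality
  using (_≡_; _≢_; refl; sym; trans; cong; subst; module ≡-Reasoning)

Colourable : ∀ {n} → Graph n → ℕ → Set
Colourable {n} G k = Σ (Fin n → Fin k) (ProperColouring G k)

HasDistinctNeighbours : ∀ {n} → Graph n → Fin n → ℕ → Set
HasDistinctNeighbours {n} G v k =
  Σ (Fin k → Fin n) λ f → Injective _≡_ _≡_ f × (∀ i → Adj G v (f i))

induce : ∀ {m n} → Graph n → (Fin m → Fin n) → Graph m
induce G f = record
  { Adj    = λ i j → Adj G (f i) (f j)
  ; adj?   = λ i j → adj? G (f i) (f j)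
  ; sym    = Graph.sym G
  ; irrefl = λ i → irrefl G (f i)
  }

removeVertex : ∀ {n} → Graph (suc n) → Fin (suc n) → Graph n
removeVertex G v = induce G (punchIn v)

punchIn-view : ∀ {n} (v u : Fin (suc n)) → v ≡ u ⊎ ∃ λ j → punchIn v j ≡ u
punchIn-view v u with v ≟ u
... | yes v≡u = inj₁ v≡u
... | no  v≢u = inj₂ (punchOut v≢u , punchIn-punchOut v≢u)

module _ {n k} (G : Graph (suc n)) (v : Fin (suc n)) (c : Fin n → Fin k) where

  UsedNextTo : Fin k → Set
  UsedNextTo col = ∃ λ j → Adj G v (punchIn v j) × c j ≡ col

  usedNextTo? : Decidable UsedNextTo
  usedNextTo? col = any? λ j → adj? G v (punchIn v j) ×-dec (c j ≟ col)

  allUsed⇒hasDistinctNeighbours : (∀ col → UsedNextTo col) → HasDistinctNeighbours G v k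
  allUsed⇒hasDistinctNeighbours used =
    punchIn v ∘ neighbour , injective , proj₁ ∘ proj₂ ∘ used
    where
    neighbour : Fin k → Fin n
    neighbour col = proj₁ (used col)

    injective : Injective _≡_ _≡_ (punchIn v ∘ neighbour)
    injective {i} {j} same = trans (sym (proj₂ (proj₂ (used i))))
      (trans (cong c (punchIn-injective v _ _ same)) (proj₂ (proj₂ (used j))))

  insertAt-proper : ProperColouring (removeVertex G v) k c →
    (col : Fin k) → ¬ UsedNextTo col → ProperColouring G k (insertAt c v col)
  insertAt-proper proper col unused = proper′
    where
    open ≡-Reasoning

    clash : ∀ j → Adj G v (punchIn v j) →
      insertAt c v col v ≢ insertAt c v col (punchIn v j)
    clash j adj same = unused (j , adj , (begin
      c j                              ≡⟨ insertAt-punchIn c v col j ⟨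
      insertAt c v col (punchIn v j)   ≡⟨ same ⟨
      insertAt c v col v               ≡⟨ insertAt-lookup c v col ⟩
      col                              ∎))

    proper′ : ProperColouring G k (insertAt c v col)
    proper′ i j adj with punchIn-view v i | punchIn-view v j
    ... | inj₁ refl         | inj₁ refl         = ⊥-elim (irrefl G v adj)
    ... | inj₁ refl         | inj₂ (j′ , refl) = clash j′ adj
    ... | inj₂ (i′ , refl) | inj₁ refl         = clash i′ (Graph.sym G adj) ∘ sym
    ... | inj₂ (i′ , refl) | inj₂ (j′ , refl) = λ same → proper i′ j′ adj (begin
      c i′                              ≡⟨ insertAt-punchIn c v col i′ ⟨
      insertAt c v col (punchIn v i′)   ≡⟨ same ⟩
      insertAt c v col (punchIn v j′)   ≡⟨ insertAt-punchIn c v col j′ ⟩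
      c j′                              ∎)

extendColouring : ∀ {n k} (G : Graph (suc n)) → ¬ (∀ v → HasDistinctNeighbours G v k) →
  (∀ v → Colourable (removeVertex G v) k) → Colourable G k
extendColouring {n} {k} G notAllSaturated colourable =
  extend (any? λ v → any? λ col → ¬? (usedNextTo? G v (colouring v) col))
  where
  colouring : ∀ v → Fin n → Fin k
  colouring v = proj₁ (colourable v)

  extend : Dec (∃₂ λ v col → ¬ UsedNextTo G v (colouring v) col) → Colourable G k
  extend (yes (v , col , unused)) =
    insertAt (colouring v) v col , insertAt-proper G v _ (proj₂ (colourable v)) col unused
  extend (no noneUnused) = contradiction saturated notAllSaturated
    where
    saturated : ∀ v → HasDistinctNeighbours G v k
    saturated v = allUsed⇒hasDistinctNeighbours G v (colouring v) λ col →
      decidable-stable (usedNextTo? G v (colouring v) col) λ unused →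
        noneUnused (v , col , unused)

module _ (k : ℕ) (P : ∀ {n} → Graph n → Set)
         (hereditary : ∀ {n} (G : Graph (suc n)) v → P G → P (removeVertex G v))
         (degenerate : ∀ {n} (G : Graph (suc n)) → P G → ¬ (∀ v → HasDistinctNeighbours G v k))
         where

  degenerate⇒colourable : ∀ {n} (G : Graph n) → P G → Colourable G k
  degenerate⇒colourable {zero}  G _  = (λ ()) , λ ()
  degenerate⇒colourable {suc n} G pG = extendColouring G (degenerate G pG) λ v →
    degenerate⇒colourable (removeVertex G v) (hereditary G v pG)

toℕ≤toℕ-punchIn : ∀ {n} i (j : Fin n) → toℕ j ≤ toℕ (punchIn i j)
toℕ≤toℕ-punchIn zero    j       = n≤1+n (toℕ j)
toℕ≤toℕ-punchIn (suc i) zero    = z≤n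
toℕ≤toℕ-punchIn (suc i) (suc j) = s≤s (toℕ≤toℕ-punchIn i j)

d+x<y⇒d+1+x<1+y : ∀ d {x y} → d + x < y → d + suc x < suc y
d+x<y⇒d+1+x<1+y d {x} {y} lt = subst (_< suc y) (sym (+-suc d x)) (s≤s lt)

punchIn-mono-gap : ∀ {n} d i (j k : Fin n) →
  d + toℕ j < toℕ k → d + toℕ (punchIn i j) < toℕ (punchIn i k)
punchIn-mono-gap d zero    j       k       gap = d+x<y⇒d+1+x<1+y d gap
punchIn-mono-gap d (suc i) zero    zero    ()
punchIn-mono-gap d (suc i) (suc j) zero    ()
punchIn-mono-gap d (suc i) zero    (suc k) gap = ≤-trans gap (s≤s (toℕ≤toℕ-punchIn i k))
punchIn-mono-gap d (suc i) (suc j) (suc k) (s≤s gap) = d+x<y⇒d+1+x<1+y d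
  (punchIn-mono-gap d i j k (subst (_≤ toℕ k) (+-suc d (toℕ j)) gap))

-- The cases d = 0 and d = 1 of the hypothesis make f preserve order and jumps.
noSecant-induce : ∀ {m n} (G : Graph n) (f : Fin m → Fin n) →
  (∀ d {j k} → d + toℕ j < toℕ k → d + toℕ (f j) < toℕ (f k)) →
  NoSecantEdges G → NoSecantEdges (induce G f)
noSecant-induce G f mono noSecant l m p q ((alm , jlm) , (apq , jpq) , crossing) =
  noSecant (f l) (f m) (f p) (f q)
    ((alm , mono 1 jlm) , (apq , mono 1 jpq) , Data.Sum.map order order crossing)
  where
  order : ∀ {w x y z} → toℕ w < toℕ x × toℕ x < toℕ y × toℕ y < toℕ z →
    toℕ (f w) < toℕ (f x) × toℕ (f x) < toℕ (f y) × toℕ (f y) < toℕ (f z)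
  order = map (mono 0) (map (mono 0) (mono 0))

noSecant-removeVertex : ∀ {n} (G : Graph (suc n)) v →
  NoSecantEdges G → NoSecantEdges (removeVertex G v)
noSecant-removeVertex G v =
  noSecant-induce G (punchIn v) λ d → punchIn-mono-gap d v _ _

pigeonhole-escape : ∀ {n m k} {R : Pred (Fin n) 0ℓ} → Decidable R → m < k →
  (pos : Fin m → ℕ) (f : Fin k → Fin n) → Injective _≡_ _≡_ f →
  (∀ i → (∃ λ c → toℕ (f i) ≡ pos c) ⊎ R (f i)) → ∃ R
pigeonhole-escape {R = R} R? m<k pos f inj located = escape (any? R?)
  where
  escape : Dec (∃ R) → ∃ R
  escape (yes found) = found
  escape (no none) = ⊥-elim (collision (pigeonhole m<k (proj₁ ∘ slot)))
    where
    slot : ∀ i → ∃ λ c → toℕ (f i) ≡ pos c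
    slot i = [ id , (λ r → contradiction (f i , r) none) ] (located i)

    collision : ¬ ∃₂ λ i j → i <ᶠ j × proj₁ (slot i) ≡ proj₁ (slot j)
    collision (i , j , i<j , sameSlot) = <⇒≢ᶠ i<j (inj (toℕ-injective (begin
      toℕ (f i)            ≡⟨ proj₂ (slot i) ⟩
      pos (proj₁ (slot i)) ≡⟨ cong pos sameSlot ⟩
      pos (proj₁ (slot j)) ≡⟨ proj₂ (slot j) ⟨
      toℕ (f j)            ∎)))
      where open ≡-Reasoning

m≤n⇒n≡m∨n≡1+m∨n≡2+m∨2+m<n : ∀ {m n} → m ≤ n →
  n ≡ m ⊎ n ≡ 1 + m ⊎ n ≡ 2 + m ⊎ 2 + m < n
m≤n⇒n≡m∨n≡1+m∨n≡2+m∨2+m<n m≤n with m≤n⇒m<n∨m≡n m≤n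
... | inj₂ m≡n = inj₁ (sym m≡n)
... | inj₁ m<n with m≤n⇒m<n∨m≡n m<n
...   | inj₂ 1+m≡n = inj₂ (inj₁ (sym 1+m≡n))
...   | inj₁ 1+m<n with m≤n⇒m<n∨m≡n 1+m<n
...     | inj₂ 2+m≡n = inj₂ (inj₂ (inj₁ (sym 2+m≡n)))
...     | inj₁ 2+m<n = inj₂ (inj₂ (inj₂ 2+m<n))

orderedJump? : ∀ {n} (G : Graph n) u w → Dec (OrderedJump G u w)
orderedJump? G u w = adj? G u w ×-dec (suc (toℕ u) <? toℕ w)

module _ {n} (G : Graph n) (noSecant : NoSecantEdges G) where

  neighbour-within-jump : ∀ {a b u w} → OrderedJump G a b →
    toℕ a < toℕ u → toℕ u < toℕ b → Adj G u w → toℕ a ≤ toℕ w × toℕ w ≤ toℕ b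
  neighbour-within-jump {a} {b} {u} {w} jab a<u u<b uw = lower , upper
    where
    lower : toℕ a ≤ toℕ w
    lower = decidable-stable (toℕ a ≤? toℕ w) λ a≰w → let w<a = ≰⇒> a≰w in
      noSecant a b w u (jab , (Graph.sym G uw , ≤-<-trans w<a a<u) , inj₂ (w<a , a<u , u<b))

    upper : toℕ w ≤ toℕ b
    upper = decidable-stable (toℕ w ≤? toℕ b) λ w≰b → let b<w = ≰⇒> w≰b in
      noSecant a b u w (jab , (uw , ≤-<-trans u<b b<w) , inj₁ (a<u , u<b , b<w))

  successorNeighbour : ∀ {a b u w} → OrderedJump G a b → toℕ u ≡ suc (toℕ a) → Adj G u w →
    toℕ w ≡ toℕ a ⊎ toℕ w ≡ 2 + toℕ a ⊎ OrderedJump G u w × toℕ w ≤ toℕ b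
  successorNeighbour {a} {b} {u} {w} jab@(_ , a+1<b) u≡a+1 uw =
    classify (m≤n⇒n≡m∨n≡1+m∨n≡2+m∨2+m<n (proj₁ bounds))
    where
    bounds : toℕ a ≤ toℕ w × toℕ w ≤ toℕ b
    bounds = neighbour-within-jump jab (subst (toℕ a <_) (sym u≡a+1) (n<1+n (toℕ a)))
                                       (subst (_< toℕ b) (sym u≡a+1) a+1<b) uw

    classify : toℕ w ≡ toℕ a ⊎ toℕ w ≡ 1 + toℕ a ⊎ toℕ w ≡ 2 + toℕ a ⊎ 2 + toℕ a < toℕ w →
      toℕ w ≡ toℕ a ⊎ toℕ w ≡ 2 + toℕ a ⊎ OrderedJump G u w × toℕ w ≤ toℕ b
    classify (inj₁ w≡a) = inj₁ w≡a
    classify (inj₂ (inj₁ w≡u)) =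
      ⊥-elim (irrefl G u (subst (Adj G u) (toℕ-injective (trans w≡u (sym u≡a+1))) uw))
    classify (inj₂ (inj₂ (inj₁ w≡a+2))) = inj₂ (inj₁ w≡a+2)
    classify (inj₂ (inj₂ (inj₂ a+2<w))) =
      inj₂ (inj₂ ((uw , subst (λ t → suc t < toℕ w) (sym u≡a+1) a+2<w) , proj₂ bounds))

  module _ (saturated : ∀ v → HasDistinctNeighbours G v 3) where

    nestedJump : ∀ {a b} → OrderedJump G a b →
      ∃₂ λ u w → toℕ a < toℕ u × toℕ w ≤ toℕ b × OrderedJump G u w
    nestedJump {a} {b} jab@(_ , a+1<b) =
      u , proj₁ inner , a<u , proj₂ (proj₂ inner) , proj₁ (proj₂ inner)
      where
      u : Fin n
      u = fromℕ< (<-trans a+1<b (toℕ<n b))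

      u≡a+1 : toℕ u ≡ suc (toℕ a)
      u≡a+1 = toℕ-fromℕ< _

      a<u : toℕ a < toℕ u
      a<u = subst (toℕ a <_) (sym u≡a+1) (n<1+n (toℕ a))

      inner : ∃ λ w → OrderedJump G u w × toℕ w ≤ toℕ b
      inner with saturated u
      ... | f , injective , adjacent =
        pigeonhole-escape (λ w → orderedJump? G u w ×-dec (toℕ w ≤? toℕ b))
          (s≤s (s≤s (s≤s z≤n))) (toℕ a ∷ 2 + toℕ a ∷ []) f injective λ i →
            [ (λ w≡a → inj₁ (zero , w≡a)) , map₁ (λ w≡a+2 → suc zero , w≡a+2) ]′
              (successorNeighbour jab u≡a+1 (adjacent i))

    noOrderedJump : ∀ d {a b} → toℕ b ≤ d + toℕ a → ¬ OrderedJump G a b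
    noOrderedJump zero    b≤a (_ , a+1<b) = <⇒≱ (<-trans (n<1+n _) a+1<b) b≤a
    noOrderedJump (suc d) {a} {b} b≤1+d+a jab with nestedJump jab
    ... | u , w , a<u , w≤b , juw = noOrderedJump d w≤d+u juw
      where
      open ≤-Reasoning
      w≤d+u : toℕ w ≤ d + toℕ u
      w≤d+u = begin
        toℕ w            ≤⟨ w≤b ⟩
        toℕ b            ≤⟨ b≤1+d+a ⟩
        suc d + toℕ a    ≡⟨ +-suc d (toℕ a) ⟨
        d + suc (toℕ a)  ≤⟨ +-monoʳ-≤ d a<u ⟩
        d + toℕ u        ∎

firstNeighbour : ∀ {n} (G : Graph (suc n)) {w} → Adj G zero w →
  toℕ w ≡ 1 ⊎ OrderedJump G zero w
firstNeighbour G {zero}        adj = ⊥-elim (irrefl G zero adj)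
firstNeighbour G {suc zero}    _   = inj₁ refl
firstNeighbour G {suc (suc _)} adj = inj₂ (adj , s≤s (s≤s z≤n))

noSecant⇒notAllSaturated : ∀ {n} (G : Graph (suc n)) → NoSecantEdges G →
  ¬ (∀ v → HasDistinctNeighbours G v 3)
noSecant⇒notAllSaturated {n} G noSecant saturated =
  noOrderedJump G noSecant saturated (toℕ b) (m≤m+n (toℕ b) 0) (proj₂ firstJump)
  where
  firstJump : ∃ (OrderedJump G zero)
  firstJump with saturated zero
  ... | f , injective , adjacent =
    pigeonhole-escape (orderedJump? G zero) (s≤s (s≤s z≤n)) (1 ∷ []) f injective λ i →
      map₁ (λ w≡1 → zero , w≡1) (firstNeighbour G (adjacent i))

  b : Fin (suc n)
  b = proj₁ firstJump

mainTheorem1 : (n : ℕ) (G : Graph n) → NoSecantEdges G →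
    Σ (Fin n → Fin 3) (λ c → ProperColouring G 3 c)
mainTheorem1 n =
  degenerate⇒colourable 3 NoSecantEdges noSecant-removeVertex noSecant⇒notAllSaturated
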